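{- Let $E, F\subseteq M_2(\mathbb F_q).$ Then we have $$ W_0(E,F)\le \frac{|E||F|}{q} + \sqrt{2} q^{2} |E|^{\frac{1}{2}}|F|^{\frac{1}{2}}.$$
   Context: $\mathbb F_q$ is a finite field with $q$ elements, $q$ an odd prime power, and $M_2(\mathbb F_q)$ is the set of $2\times 2$ matrices over $\mathbb F_q$. For $x=\left(\begin{matrix} x_1&x_2\\ x_3&x_4\end{matrix}\right), y=\left(\begin{matrix} y_1&y_2\\ y_3&y_4\end{matrix}\right)\in M_2(\mathbb F_q)$, the Odot-product is $x\odot y= x_1y_4-x_2y_3-x_3y_2+x_4y_1$. For $\ell\in\mathbb F_q$, $W_\ell(E,F)$ denotes the number of pairs $(x,y)\in E\times F$ such that $x\odot y=\ell$. -}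

module Defs where

open import Level using (0ℓ)
open import Data.Nat using (ℕ)
open import Data.Fin using (Fin)
open import Data.Fin.Properties using () renaming (_≟_ to _≟ᶠ_)
open import Data.List using (List; map; allFin; length; filter; concatMap; cartesianProduct)
open import Data.Bool using (Bool; true; false; T)
open import Data.Product using (_×_; _,_; Σ; ∃)
open import Relation.Nullary using (¬_; Dec; yes; no)
open import Relation.Nullary.Decidable using (map′)
open import Relation.Binary.PropositionalEquality using (_≡_; refl; cong; sym; trans)
open import Function.Bundles using (_↔_; Inverse)
open import Algebra.Structures using (IsCommutativeRing)

record FiniteField : Set₁ where
  field
    Carrier : Set
    _+_ _*_ : Carrier → Carrier → Carrier
    -_      : Carrier → Carrier
    0# 1#   : Carrier
    isCommutativeRing : IsCommutativeRing _≡_ _+_ _*_ -_ 0# 1#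
    0≢1     : ¬ (0# ≡ 1#)
    inverse : ∀ x → ¬ (x ≡ 0#) → Σ Carrier (λ y → x * y ≡ 1#)
    size    : ℕ
    enum    : Carrier ↔ Fin size

  _-_ : Carrier → Carrier → Carrier
  x - y = x + (- y)

  _≟_ : (x y : Carrier) → Dec (x ≡ y)
  x ≟ y = map′ (λ e → trans (sym (Inverse.strictlyInverseʳ enum x))
                       (trans (cong (Inverse.from enum) e) (Inverse.strictlyInverseʳ enum y)))
               (cong (Inverse.to enum))
               (Inverse.to enum x ≟ᶠ Inverse.to enum y)

  elements : List Carrier
  elements = map (Inverse.from enum) (allFin size)

  -- 2×2 matrices ( x₁ x₂ ; x₃ x₄ ) as quadruples (x₁ , x₂ , x₃ , x₄)
  M₂ : Set
  M₂ = Carrier × Carrier × Carrier × Carrier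

  allM₂ : List M₂
  allM₂ = concatMap (λ a → concatMap (λ b → concatMap (λ c → map (λ d → a , b , c , d)
            elements) elements) elements) elements

  _⊙_ : M₂ → M₂ → Carrier
  (x₁ , x₂ , x₃ , x₄) ⊙ (y₁ , y₂ , y₃ , y₄) =
    (((x₁ * y₄) - (x₂ * y₃)) - (x₃ * y₂)) + (x₄ * y₁)

  Subset : Set
  Subset = M₂ → Bool

  card : Subset → ℕ
  card E = length (filter (λ x → T? (E x)) allM₂)
    where
      T? : (b : Bool) → Dec (T b)
      T? true  = yes _
      T? false = no (λ ())

  W : Carrier → Subset → Subset → ℕ
  W ℓ E F = length (filter (λ p → decPair p) (cartesianProduct allM₂ allM₂))
    where
      decPair : (p : M₂ × M₂) → Dec (T (E (Data.Product.proj₁ p)) × T (F (Data.Product.proj₂ p)) × (Data.Product.proj₁ p ⊙ Data.Product.proj₂ p ≡ ℓ))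
      decPair (x , y) with E x | F y | (x ⊙ y) ≟ ℓ
      ... | true  | true  | yes e = yes (_ , _ , e)
      ... | true  | true  | no ne = no (λ { (_ , _ , e) → ne e })
      ... | true  | false | _ = no (λ { (_ , () , _) })
      ... | false | _     | _ = no (λ { (() , _ , _) })

module Submission where

-- Write χ t = q [t = 0] − 1 and D y = Σ_{x ∈ E} χ (x ⊙ y). Summing D over F gives q W₀(E,F) − |E||F|, so by
-- Cauchy–Schwarz (q W₀ − |E||F|)² ≤ |F| Σ_y D(y)² = |F| Σ_{x,x′ ∈ E} G x x′ with G x x′ = Σ_y χ (x ⊙ y) χ (x′ ⊙ y).
-- As x ⊙ y is a dot product σ x · y on F_q⁴ and Σ_{v ∈ F_qⁿ} χ (k · v + b) = qⁿ [k = 0] χ b, the kernel G is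
-- nonnegative (solve the first linear form for one coordinate and induct on the dimension) and every row sum
-- Σ_{x′} G x x′ equals q⁴ (q − 1)². Hence (q W₀ − |E||F|)² ≤ q⁴ (q − 1)² |E||F| ≤ 2 q⁶ |E||F|, which is the paper's
-- bound multiplied by q and squared.

open import Algebra.Bundles using (CommutativeRing)
open import Data.Bool.Base using (Bool; true; false; T)
open import Data.Fin.Base as Fin using (Fin; zero; suc)
import Data.Fin.Properties as Fin
open import Data.Integer.Base as ℤ using (ℤ; -[1+_]; 0ℤ; 1ℤ; +≤+)
import Data.Integer.Properties as ℤ
open import Data.List.Base using (List; []; _∷_; _++_; map; concatMap; cartesianProduct; allFin; length; filter)
open import Data.List.Properties using (map-tabulate; length-map; length-tabulate)
import Data.Maybe.Base as Maybe
open import Data.Nat.Base as ℕ using (ℕ; zero; suc; _∸_)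
import Data.Nat.Properties as ℕ
open import Data.Product.Base using (_,_; proj₁; proj₂)
import Data.Sign.Base as Sign
open import Data.Vec.Base using (Vec; []; _∷_; zipWith; replicate)
open import Function.Base using (id; _∘_)
open import Function.Bundles using (Inverse; mk⇔)
open import Level using (Level; 0ℓ)
open import Relation.Binary.PropositionalEquality
  using (_≡_; _≢_; refl; sym; trans; cong; cong₂; subst; module ≡-Reasoning)
open import Relation.Nullary using (Dec; yes; no; does; ¬_)
open import Relation.Nullary.Decidable using (dec-true; dec-false; does-⇔; dec⇒maybe)

open import Defs

-- The reflective Tactic.RingSolver does not work for a ring given as a module parameter, so field identities use
-- Algebra.Solver.Ring with integer coefficients, interpreted through the canonical map ℤ → R.
module IntegerCoefficientSolver {c ℓ} (R : CommutativeRing c ℓ) where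

  open CommutativeRing R renaming (refl to ≈-refl; sym to ≈-sym; trans to ≈-trans)
  open import Algebra.Properties.Ring ring using (-‿distribˡ-*; -‿distribʳ-*; -‿involutive; -0#≈0#)
  open import Algebra.Properties.AbelianGroup +-abelianGroup using (⁻¹-∙-comm)
  open import Algebra.Properties.CommutativeSemigroup +-commutativeSemigroup using (interchange)
  open import Algebra.Properties.Semiring.Mult.TCOptimised semiring using (_×_; ×-homo-+; ×1-homo-*; 1+×)
  open import Algebra.Solver.Ring.AlmostCommutativeRing using (fromCommutativeRing; _-Raw-AlmostCommutative⟶_)
  open import Relation.Binary.Reasoning.Setoid setoid

  fromℤ : ℤ → Carrier
  fromℤ (ℤ.+ n)    = n × 1#
  fromℤ (-[1+ n ]) = - (suc n × 1#)

  fromℤ-neg◃ : ∀ n → fromℤ (Sign.- ℤ.◃ n) ≈ - (n × 1#)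
  fromℤ-neg◃ zero    = ≈-sym -0#≈0#
  fromℤ-neg◃ (suc n) = ≈-refl

  fromℤ-⊖ : ∀ m n → fromℤ (m ℤ.⊖ n) ≈ m × 1# - n × 1#
  fromℤ-⊖ m       zero    = ≈-sym (≈-trans (+-congˡ -0#≈0#) (+-identityʳ _))
  fromℤ-⊖ zero    (suc n) = ≈-sym (+-identityˡ _)
  fromℤ-⊖ (suc m) (suc n) = begin
    fromℤ (suc m ℤ.⊖ suc n)          ≡⟨ cong fromℤ (ℤ.[1+m]⊖[1+n]≡m⊖n m n) ⟩
    fromℤ (m ℤ.⊖ n)                  ≈⟨ fromℤ-⊖ m n ⟩
    m × 1# - n × 1#                  ≈⟨ +-identityˡ _ ⟨
    0# + (m × 1# - n × 1#)           ≈⟨ +-congʳ (-‿inverseʳ 1#) ⟨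
    (1# - 1#) + (m × 1# - n × 1#)    ≈⟨ interchange 1# (- 1#) (m × 1#) (- (n × 1#)) ⟩
    (1# + m × 1#) + (- 1# - n × 1#)  ≈⟨ +-congˡ (⁻¹-∙-comm 1# (n × 1#)) ⟩
    (1# + m × 1#) - (1# + n × 1#)    ≈⟨ +-cong (1+× m 1#) (-‿cong (1+× n 1#)) ⟨
    suc m × 1# - suc n × 1#          ∎

  fromℤ-+ : ∀ i j → fromℤ (i ℤ.+ j) ≈ fromℤ i + fromℤ j
  fromℤ-+ (ℤ.+ m)    (ℤ.+ n)    = ×-homo-+ 1# m n
  fromℤ-+ (ℤ.+ m)    -[1+ n ]   = fromℤ-⊖ m (suc n)
  fromℤ-+ -[1+ m ]   (ℤ.+ n)    = ≈-trans (fromℤ-⊖ n (suc m)) (+-comm _ _)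
  fromℤ-+ -[1+ m ]   -[1+ n ]   = begin
    - (suc (suc (m ℕ.+ n)) × 1#)          ≡⟨ cong (λ k → - (suc k × 1#)) (ℕ.+-suc m n) ⟨
    - ((suc m ℕ.+ suc n) × 1#)            ≈⟨ -‿cong (×-homo-+ 1# (suc m) (suc n)) ⟩
    - (suc m × 1# + suc n × 1#)           ≈⟨ ⁻¹-∙-comm _ _ ⟨
    - (suc m × 1#) + - (suc n × 1#)       ∎

  fromℤ-* : ∀ i j → fromℤ (i ℤ.* j) ≈ fromℤ i * fromℤ j
  fromℤ-* (ℤ.+ m)    (ℤ.+ n)    = ≈-trans (reflexive (cong fromℤ (ℤ.+◃n≡+n (m ℕ.* n)))) (×1-homo-* m n)
  fromℤ-* (ℤ.+ m)    -[1+ n ]   =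
    ≈-trans (fromℤ-neg◃ (m ℕ.* suc n)) (≈-trans (-‿cong (×1-homo-* m (suc n))) (-‿distribʳ-* _ _))
  fromℤ-* -[1+ m ]   (ℤ.+ n)    =
    ≈-trans (fromℤ-neg◃ (suc m ℕ.* n)) (≈-trans (-‿cong (×1-homo-* (suc m) n)) (-‿distribˡ-* _ _))
  fromℤ-* -[1+ m ]   -[1+ n ]   = begin
    (suc m ℕ.* suc n) × 1#                ≈⟨ ×1-homo-* (suc m) (suc n) ⟩
    suc m × 1# * suc n × 1#               ≈⟨ -‿involutive _ ⟨
    - - (suc m × 1# * suc n × 1#)         ≈⟨ -‿cong (-‿distribˡ-* _ _) ⟩
    - (- (suc m × 1#) * suc n × 1#)       ≈⟨ -‿distribʳ-* _ _ ⟩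
    - (suc m × 1#) * - (suc n × 1#)       ∎

  fromℤ-neg : ∀ i → fromℤ (ℤ.- i) ≈ - fromℤ i
  fromℤ-neg (ℤ.+ zero)  = ≈-sym -0#≈0#
  fromℤ-neg (ℤ.+ suc n) = ≈-refl
  fromℤ-neg -[1+ n ]    = ≈-sym (-‿involutive _)

  fromℤ-morphism : ℤ.+-*-rawRing -Raw-AlmostCommutative⟶ fromCommutativeRing R
  fromℤ-morphism = record
    { ⟦_⟧    = fromℤ
    ; +-homo = fromℤ-+
    ; *-homo = fromℤ-*
    ; -‿homo = fromℤ-neg
    ; 0-homo = ≈-refl
    ; 1-homo = ≈-refl
    }

  open import Algebra.Solver.Ring ℤ.+-*-rawRing (fromCommutativeRing R) fromℤ-morphism
    (λ i j → Maybe.map (λ i≡j → reflexive (cong fromℤ i≡j)) (dec⇒maybe (i ℤ.≟ j)))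
    public using (solve; _:=_; _:+_; _:*_; _:-_; :-_; con)


module FiniteSums where

  open import Data.Integer.Base using (_+_; _*_; _-_; _^_; _≤_)
  open import Data.Integer.Tactic.RingSolver using (solve-∀)
  open import Data.Product.Base using (_×_)
  open import Algebra.Properties.CommutativeSemigroup ℤ.+-commutativeSemigroup using () renaming (interchange to +-interchange)

  private variable
    ℓ ℓ′ : Level
    A : Set ℓ
    B : Set ℓ′

  𝟙 : Bool → ℤ
  𝟙 true  = 1ℤ
  𝟙 false = 0ℤ

  [_] : ∀ {p} {P : Set p} → Dec P → ℤ
  [ P? ] = 𝟙 (does P?)

  0≤𝟙 : ∀ a → 0ℤ ≤ 𝟙 a
  0≤𝟙 true  = +≤+ ℕ.z≤n
  0≤𝟙 false = +≤+ ℕ.z≤n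

  𝟙≤1 : ∀ a → 𝟙 a ≤ 1ℤ
  𝟙≤1 true  = +≤+ ℕ.≤-refl
  𝟙≤1 false = +≤+ ℕ.z≤n

  𝟙-T : ∀ a (T? : Dec (T a)) → [ T? ] ≡ 𝟙 a
  𝟙-T true  T? = cong 𝟙 (dec-true T? _)
  𝟙-T false T? = cong 𝟙 (dec-false T? (λ ()))

  [_]-yes : ∀ {p} {P : Set p} (P? : Dec P) → P → [ P? ] ≡ 1ℤ
  [ P? ]-yes p = cong 𝟙 (dec-true P? p)

  [_]-no : ∀ {p} {P : Set p} (P? : Dec P) → ¬ P → [ P? ] ≡ 0ℤ
  [ P? ]-no ¬p = cong 𝟙 (dec-false P? ¬p)

  []-⇔ : ∀ {p q} {P : Set p} {Q : Set q} (P? : Dec P) (Q? : Dec Q) → (P → Q) → (Q → P) → [ P? ] ≡ [ Q? ]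
  []-⇔ P? Q? P→Q Q→P = cong 𝟙 (does-⇔ (mk⇔ P→Q Q→P) P? Q?)

  []-T×T× : ∀ a b {q} {Q : Set q} (Q? : Dec Q) (R? : Dec (T a × T b × Q)) → [ R? ] ≡ 𝟙 a * (𝟙 b * [ Q? ])
  []-T×T× true  true  Q? R? = trans ([]-⇔ R? Q? (λ (_ , _ , q) → q) (λ q → _ , _ , q))
                                    (sym (trans (ℤ.*-identityˡ _) (ℤ.*-identityˡ _)))
  []-T×T× true  false Q? R? = [ R? ]-no (λ ())
  []-T×T× false b     Q? R? = [ R? ]-no (λ ())

  𝟙*≤ : ∀ a {i} → 0ℤ ≤ i → 𝟙 a * i ≤ i
  𝟙*≤ true  {i} _   = ℤ.≤-reflexive (ℤ.*-identityˡ i)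
  𝟙*≤ false     0≤i = 0≤i

  𝟙*-mono : ∀ a {i j} → i ≤ j → 𝟙 a * i ≤ 𝟙 a * j
  𝟙*-mono a = ℤ.*-monoˡ-≤-nonNeg (𝟙 a) {{ℤ.nonNegative (0≤𝟙 a)}}

  ∑ : List A → (A → ℤ) → ℤ
  ∑ []       f = 0ℤ
  ∑ (x ∷ xs) f = f x + ∑ xs f

  syntax ∑ xs (λ x → e) = ∑[ x ∈ xs ] e

  ∑-cong : ∀ (xs : List A) {f g : A → ℤ} → (∀ x → f x ≡ g x) → ∑ xs f ≡ ∑ xs g
  ∑-cong []       f≗g = refl
  ∑-cong (x ∷ xs) f≗g = cong₂ _+_ (f≗g x) (∑-cong xs f≗g)

  ∑-distrib-+ : ∀ (xs : List A) (f g : A → ℤ) → ∑[ x ∈ xs ] (f x + g x) ≡ ∑ xs f + ∑ xs g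
  ∑-distrib-+ []       f g = refl
  ∑-distrib-+ (x ∷ xs) f g = trans (cong ((f x + g x) +_) (∑-distrib-+ xs f g)) (+-interchange (f x) (g x) (∑ xs f) (∑ xs g))

  *-distribˡ-∑ : ∀ c (xs : List A) (f : A → ℤ) → c * ∑ xs f ≡ ∑[ x ∈ xs ] (c * f x)
  *-distribˡ-∑ c []       f = ℤ.*-zeroʳ c
  *-distribˡ-∑ c (x ∷ xs) f = trans (ℤ.*-distribˡ-+ c (f x) (∑ xs f)) (cong (c * f x +_) (*-distribˡ-∑ c xs f))

  *-distribʳ-∑ : ∀ c (xs : List A) (f : A → ℤ) → ∑ xs f * c ≡ ∑[ x ∈ xs ] (f x * c)
  *-distribʳ-∑ c xs f = trans (ℤ.*-comm (∑ xs f) c) (trans (*-distribˡ-∑ c xs f) (∑-cong xs (λ x → ℤ.*-comm c (f x))))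

  ∑-const : ∀ (xs : List A) c → ∑[ x ∈ xs ] c ≡ ℤ.+ length xs * c
  ∑-const []       c = sym (ℤ.*-zeroˡ c)
  ∑-const (x ∷ xs) c = trans (cong (c +_) (∑-const xs c)) (sym (ℤ.suc-* (ℤ.+ length xs) c))

  ∑-++ : ∀ (xs ys : List A) (f : A → ℤ) → ∑ (xs ++ ys) f ≡ ∑ xs f + ∑ ys f
  ∑-++ []       ys f = sym (ℤ.+-identityˡ _)
  ∑-++ (x ∷ xs) ys f = trans (cong (f x +_) (∑-++ xs ys f)) (sym (ℤ.+-assoc (f x) _ _))

  ∑-zero : ∀ (xs : List A) → ∑[ x ∈ xs ] 0ℤ ≡ 0ℤ
  ∑-zero []       = refl
  ∑-zero (x ∷ xs) = trans (ℤ.+-identityˡ _) (∑-zero xs)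

  ∑-mono-≤ : ∀ (xs : List A) {f g : A → ℤ} → (∀ x → f x ≤ g x) → ∑ xs f ≤ ∑ xs g
  ∑-mono-≤ []       f≤g = ℤ.≤-refl
  ∑-mono-≤ (x ∷ xs) f≤g = ℤ.+-mono-≤ (f≤g x) (∑-mono-≤ xs f≤g)

  ∑-nonneg : ∀ (xs : List A) {f : A → ℤ} → (∀ x → 0ℤ ≤ f x) → 0ℤ ≤ ∑ xs f
  ∑-nonneg []       0≤f = ℤ.≤-refl
  ∑-nonneg (x ∷ xs) 0≤f = ℤ.+-mono-≤ (0≤f x) (∑-nonneg xs 0≤f)

  length-filter : ∀ {p} {P : A → Set p} (P? : ∀ x → Dec (P x)) xs → ℤ.+ length (filter P? xs) ≡ ∑[ x ∈ xs ] [ P? x ]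
  length-filter P? []       = refl
  length-filter P? (x ∷ xs) with does (P? x)
  ... | true  = cong (1ℤ +_) (length-filter P? xs)
  ... | false = trans (length-filter P? xs) (sym (ℤ.+-identityˡ _))

  ∑-map : ∀ (g : A → B) (xs : List A) (f : B → ℤ) → ∑ (map g xs) f ≡ ∑[ x ∈ xs ] f (g x)
  ∑-map g []       f = refl
  ∑-map g (x ∷ xs) f = cong (f (g x) +_) (∑-map g xs f)

  ∑-concatMap : ∀ (g : A → List B) (xs : List A) (f : B → ℤ) → ∑ (concatMap g xs) f ≡ ∑[ x ∈ xs ] ∑ (g x) f
  ∑-concatMap g []       f = refl
  ∑-concatMap g (x ∷ xs) f = trans (∑-++ (g x) (concatMap g xs) f) (cong (∑ (g x) f +_) (∑-concatMap g xs f))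

  ∑-cartesianProduct : ∀ (xs : List A) (ys : List B) (f : A × B → ℤ) →
                       ∑ (cartesianProduct xs ys) f ≡ ∑[ x ∈ xs ] ∑[ y ∈ ys ] f (x , y)
  ∑-cartesianProduct []       ys f = refl
  ∑-cartesianProduct (x ∷ xs) ys f =
    trans (∑-++ (map (x ,_) ys) _ f) (cong₂ _+_ (∑-map (x ,_) ys f) (∑-cartesianProduct xs ys f))

  ∑-comm : ∀ (xs : List A) (ys : List B) (f : A → B → ℤ) →
           ∑[ x ∈ xs ] ∑[ y ∈ ys ] f x y ≡ ∑[ y ∈ ys ] ∑[ x ∈ xs ] f x y
  ∑-comm []       ys f = sym (∑-zero ys)
  ∑-comm (x ∷ xs) ys f = trans (cong (∑ ys (f x) +_) (∑-comm xs ys f)) (sym (∑-distrib-+ ys (f x) _))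

  ∑∑-distrib-+ : ∀ (xs : List A) (ys : List B) (f g : A → B → ℤ) →
                 ∑[ x ∈ xs ] ∑[ y ∈ ys ] (f x y + g x y)
                   ≡ ∑[ x ∈ xs ] ∑[ y ∈ ys ] f x y + ∑[ x ∈ xs ] ∑[ y ∈ ys ] g x y
  ∑∑-distrib-+ xs ys f g = trans (∑-cong xs (λ x → ∑-distrib-+ ys (f x) (g x))) (∑-distrib-+ xs _ _)

  ∑∑-product : ∀ (xs : List A) (ys : List B) (f : A → ℤ) (g : B → ℤ) →
               ∑[ x ∈ xs ] ∑[ y ∈ ys ] (f x * g y) ≡ ∑ xs f * ∑ ys g
  ∑∑-product xs ys f g = begin
    ∑[ x ∈ xs ] ∑[ y ∈ ys ] (f x * g y) ≡⟨ ∑-cong xs (λ x → *-distribˡ-∑ (f x) ys g) ⟨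
    ∑[ x ∈ xs ] (f x * ∑ ys g)         ≡⟨ *-distribʳ-∑ (∑ ys g) xs f ⟨
    ∑ xs f * ∑ ys g                   ∎
    where open ≡-Reasoning

  ∑-square-∑ : ∀ (xs : List A) (ys : List B) (a : A → B → ℤ) →
               ∑[ y ∈ ys ] ((∑[ x ∈ xs ] a x y) * (∑[ x ∈ xs ] a x y))
                 ≡ ∑[ x ∈ xs ] ∑[ x′ ∈ xs ] ∑[ y ∈ ys ] (a x y * a x′ y)
  ∑-square-∑ xs ys a = begin
    ∑[ y ∈ ys ] ((∑[ x ∈ xs ] a x y) * (∑[ x ∈ xs ] a x y))
      ≡⟨ ∑-cong ys (λ y → trans (*-distribʳ-∑ _ xs (λ x → a x y))
                                (∑-cong xs (λ x → *-distribˡ-∑ (a x y) xs (λ x′ → a x′ y)))) ⟩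
    ∑[ y ∈ ys ] ∑[ x ∈ xs ] ∑[ x′ ∈ xs ] (a x y * a x′ y)
      ≡⟨ ∑-comm ys xs _ ⟩
    ∑[ x ∈ xs ] ∑[ y ∈ ys ] ∑[ x′ ∈ xs ] (a x y * a x′ y)
      ≡⟨ ∑-cong xs (λ x → ∑-comm ys xs _) ⟩
    ∑[ x ∈ xs ] ∑[ x′ ∈ xs ] ∑[ y ∈ ys ] (a x y * a x′ y) ∎
    where open ≡-Reasoning

  0≤i*i : ∀ i → 0ℤ ≤ i * i
  0≤i*i (ℤ.+ zero)  = +≤+ ℕ.z≤n
  0≤i*i (ℤ.+ suc n) = +≤+ ℕ.z≤n
  0≤i*i -[1+ n ]    = +≤+ ℕ.z≤n

  0≤i*j : ∀ {i j} → 0ℤ ≤ i → 0ℤ ≤ j → 0ℤ ≤ i * j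
  0≤i*j {i} {j} 0≤i 0≤j = subst (_≤ i * j) (ℤ.*-zeroʳ i) (ℤ.*-monoˡ-≤-nonNeg i {{ℤ.nonNegative 0≤i}} 0≤j)

  ∑-cauchy-schwarz : ∀ {A : Set ℓ} (xs : List A) (w b : A → ℤ) → (∀ x → 0ℤ ≤ w x) →
                     (∑[ x ∈ xs ] (w x * b x)) * (∑[ x ∈ xs ] (w x * b x)) ≤ ∑ xs w * ∑[ x ∈ xs ] (w x * (b x * b x))
  ∑-cauchy-schwarz {A = A} xs w b 0≤w =
    ℤ.0≤i-j⇒j≤i (ℤ.*-cancelˡ-≤-pos 0ℤ _ (ℤ.+ 2) (subst (0ℤ ≤_) pairs≡ 0≤pairs))
    where
    wb wbb : A → ℤ
    wb  x = w x * b x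
    wbb x = w x * (b x * b x)

    0≤pairs : 0ℤ ≤ ∑[ x ∈ xs ] ∑[ y ∈ xs ] (w x * w y * ((b x - b y) * (b x - b y)))
    0≤pairs = ∑-nonneg xs (λ x → ∑-nonneg xs (λ y → 0≤i*j (0≤i*j (0≤w x) (0≤w y)) (0≤i*i (b x - b y))))

    expand : ∀ wx wy bx by → wx * wy * ((bx - by) * (bx - by)) ≡
             wx * (bx * bx) * wy + wx * (wy * (by * by)) + ℤ.-[1+ 1 ] * (wx * bx) * (wy * by)
    expand = solve-∀

    collect : ∀ W S₁ S₂ → S₂ * W + W * S₂ + ℤ.-[1+ 1 ] * S₁ * S₁ ≡ ℤ.+ 2 * (W * S₂ - S₁ * S₁)
    collect = solve-∀

    pairs≡ : ∑[ x ∈ xs ] ∑[ y ∈ xs ] (w x * w y * ((b x - b y) * (b x - b y)))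
             ≡ ℤ.+ 2 * (∑ xs w * ∑ xs wbb - ∑ xs wb * ∑ xs wb)
    pairs≡ = begin
      ∑[ x ∈ xs ] ∑[ y ∈ xs ] (w x * w y * ((b x - b y) * (b x - b y)))
        ≡⟨ ∑-cong xs (λ x → ∑-cong xs (λ y → expand (w x) (w y) (b x) (b y))) ⟩
      ∑[ x ∈ xs ] ∑[ y ∈ xs ] (wbb x * w y + w x * wbb y + ℤ.-[1+ 1 ] * wb x * wb y)
        ≡⟨ ∑∑-distrib-+ xs xs (λ x y → wbb x * w y + w x * wbb y) (λ x y → ℤ.-[1+ 1 ] * wb x * wb y) ⟩
      ∑[ x ∈ xs ] ∑[ y ∈ xs ] (wbb x * w y + w x * wbb y) + ∑[ x ∈ xs ] ∑[ y ∈ xs ] (ℤ.-[1+ 1 ] * wb x * wb y)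
        ≡⟨ cong (_+ ∑[ x ∈ xs ] ∑[ y ∈ xs ] (ℤ.-[1+ 1 ] * wb x * wb y))
                (∑∑-distrib-+ xs xs (λ x y → wbb x * w y) (λ x y → w x * wbb y)) ⟩
      ∑[ x ∈ xs ] ∑[ y ∈ xs ] (wbb x * w y) + ∑[ x ∈ xs ] ∑[ y ∈ xs ] (w x * wbb y)
        + ∑[ x ∈ xs ] ∑[ y ∈ xs ] (ℤ.-[1+ 1 ] * wb x * wb y)
        ≡⟨ cong₂ _+_ (cong₂ _+_ (∑∑-product xs xs wbb w) (∑∑-product xs xs w wbb))
                     (∑∑-product xs xs (λ x → ℤ.-[1+ 1 ] * wb x) wb) ⟩
      ∑ xs wbb * ∑ xs w + ∑ xs w * ∑ xs wbb + (∑[ x ∈ xs ] (ℤ.-[1+ 1 ] * wb x)) * ∑ xs wb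
        ≡⟨ cong (λ s → ∑ xs wbb * ∑ xs w + ∑ xs w * ∑ xs wbb + s * ∑ xs wb) (*-distribˡ-∑ ℤ.-[1+ 1 ] xs wb) ⟨
      ∑ xs wbb * ∑ xs w + ∑ xs w * ∑ xs wbb + ℤ.-[1+ 1 ] * ∑ xs wb * ∑ xs wb
        ≡⟨ collect (∑ xs w) (∑ xs wb) (∑ xs wbb) ⟩
      ℤ.+ 2 * (∑ xs w * ∑ xs wbb - ∑ xs wb * ∑ xs wb) ∎
      where open ≡-Reasoning

  ∑-allFin-suc : ∀ {n} (g : Fin (suc n) → ℤ) → ∑ (allFin (suc n)) g ≡ g zero + ∑[ i ∈ allFin n ] g (suc i)
  ∑-allFin-suc {n} g = cong (g zero +_) (trans (cong (λ is → ∑ is g) (sym (map-tabulate id suc))) (∑-map suc (allFin n) g))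

  ∑-allFin-kronecker : ∀ {n} (j : Fin n) (g : Fin n → ℤ) → ∑[ i ∈ allFin n ] ([ i Fin.≟ j ] * g i) ≡ g j
  ∑-allFin-kronecker {suc n} zero g = begin
    ∑[ i ∈ allFin (suc n) ] ([ i Fin.≟ zero ] * g i)
      ≡⟨ ∑-allFin-suc (λ i → [ i Fin.≟ zero ] * g i) ⟩
    1ℤ * g zero + ∑[ i ∈ allFin n ] (0ℤ * g (suc i))
      ≡⟨ cong₂ _+_ (ℤ.*-identityˡ (g zero)) (∑-cong (allFin n) (λ i → ℤ.*-zeroˡ (g (suc i)))) ⟩
    g zero + ∑[ i ∈ allFin n ] 0ℤ
      ≡⟨ trans (cong (g zero +_) (∑-zero (allFin n))) (ℤ.+-identityʳ (g zero)) ⟩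
    g zero ∎
    where open ≡-Reasoning
  ∑-allFin-kronecker {suc n} (suc j) g = begin
    ∑[ i ∈ allFin (suc n) ] ([ i Fin.≟ suc j ] * g i)           ≡⟨ ∑-allFin-suc (λ i → [ i Fin.≟ suc j ] * g i) ⟩
    0ℤ * g zero + ∑[ i ∈ allFin n ] ([ i Fin.≟ j ] * g (suc i)) ≡⟨ ℤ.+-identityˡ _ ⟩
    ∑[ i ∈ allFin n ] ([ i Fin.≟ j ] * g (suc i))               ≡⟨ ∑-allFin-kronecker j (g ∘ suc) ⟩
    g (suc j)                                                   ∎
    where open ≡-Reasoning

  pos-^ : ∀ m n → ℤ.+ (m ℕ.^ n) ≡ (ℤ.+ m) ^ n
  pos-^ m zero    = refl
  pos-^ m (suc n) = trans (ℤ.pos-* m (m ℕ.^ n)) (cong (ℤ.+ m *_) (pos-^ m n))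

  length-filter-𝟙 : ∀ (a : A → Bool) (P? : ∀ x → Dec (T (a x))) xs → ℤ.+ length (filter P? xs) ≡ ∑[ x ∈ xs ] 𝟙 (a x)
  length-filter-𝟙 a P? xs = trans (length-filter P? xs) (∑-cong xs (λ x → 𝟙-T (a x) (P? x)))

  length-filter-pairs : ∀ {q} (a : A → Bool) (b : B → Bool) {Q : A → B → Set q} (Q? : ∀ x y → Dec (Q x y))
    (R? : ∀ (p : A × B) → Dec (T (a (proj₁ p)) × T (b (proj₂ p)) × Q (proj₁ p) (proj₂ p))) xs ys →
    ℤ.+ length (filter R? (cartesianProduct xs ys)) ≡ ∑[ x ∈ xs ] ∑[ y ∈ ys ] (𝟙 (a x) * (𝟙 (b y) * [ Q? x y ]))
  length-filter-pairs a b Q? R? xs ys = begin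
    ℤ.+ length (filter R? (cartesianProduct xs ys))  ≡⟨ length-filter R? (cartesianProduct xs ys) ⟩
    ∑ (cartesianProduct xs ys) (λ p → [ R? p ])      ≡⟨ ∑-cartesianProduct xs ys (λ p → [ R? p ]) ⟩
    ∑[ x ∈ xs ] ∑[ y ∈ ys ] [ R? (x , y) ]
      ≡⟨ ∑-cong xs (λ x → ∑-cong ys (λ y → []-T×T× (a x) (b y) (Q? x y) (R? (x , y)))) ⟩
    ∑[ x ∈ xs ] ∑[ y ∈ ys ] (𝟙 (a x) * (𝟙 (b y) * [ Q? x y ])) ∎
    where open ≡-Reasoning

  ∸-square-≤ : ∀ m n r → (ℤ.+ m - ℤ.+ n) * (ℤ.+ m - ℤ.+ n) ≤ ℤ.+ r → (m ∸ n) ℕ.^ 2 ℕ.≤ r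
  ∸-square-≤ m n r bound with n ℕ.≤? m
  ... | yes n≤m = ℤ.drop‿+≤+ (subst (_≤ ℤ.+ r) (sym cast) bound)
    where
    cast : ℤ.+ ((m ∸ n) ℕ.^ 2) ≡ (ℤ.+ m - ℤ.+ n) * (ℤ.+ m - ℤ.+ n)
    cast = begin
      ℤ.+ ((m ∸ n) ℕ.^ 2)                    ≡⟨ pos-^ (m ∸ n) 2 ⟩
      ℤ.+ (m ∸ n) * (ℤ.+ (m ∸ n) * 1ℤ)        ≡⟨ cong (ℤ.+ (m ∸ n) *_) (ℤ.*-identityʳ _) ⟩
      ℤ.+ (m ∸ n) * ℤ.+ (m ∸ n)               ≡⟨ cong (λ i → i * i) (sym (trans (ℤ.m-n≡m⊖n m n) (ℤ.⊖-≥ n≤m))) ⟩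
      (ℤ.+ m - ℤ.+ n) * (ℤ.+ m - ℤ.+ n)       ∎
      where open ≡-Reasoning
  ... | no n≰m = subst (λ k → k ℕ.^ 2 ℕ.≤ r) (sym (ℕ.m≤n⇒m∸n≡0 (ℕ.<⇒≤ (ℕ.≰⇒> n≰m)))) ℕ.z≤n


module OdotKernel (K : FiniteField) where

  open FiniteSums
  open import Data.Integer.Base using (_+_; _*_; _-_; _^_; _≤_)
  open import Data.Integer.Tactic.RingSolver using (solve-∀)
  open FiniteField K using (Carrier; _≟_; elements; enum; inverse; size; isCommutativeRing; M₂; allM₂; _⊙_; Subset; card; W)

  ring : CommutativeRing 0ℓ 0ℓ
  ring = record { isCommutativeRing = isCommutativeRing }

  open CommutativeRing ring using (0#; 1#) renaming (_+_ to _⊕_; _*_ to _⊗_; -_ to ⊝_)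
  open IntegerCoefficientSolver ring

  inv : (a : Carrier) → a ≢ 0# → Carrier
  inv a a≢0 = proj₁ (inverse a a≢0)

  q : ℤ
  q = ℤ.+ size

  δ : Carrier → ℤ
  δ t = [ t ≟ 0# ]

  χ : Carrier → ℤ
  χ t = q * δ t - 1ℤ

  ∑-elements-const : ∀ c → ∑[ t ∈ elements ] c ≡ q * c
  ∑-elements-const c = trans (∑-const elements c) (cong (λ n → ℤ.+ n * c) length-elements)
    where
    length-elements : length elements ≡ size
    length-elements = trans (length-map (Inverse.from enum) (allFin size)) (length-tabulate id)

  ∑-elements-kronecker : ∀ t₀ (g : Carrier → ℤ) → ∑[ t ∈ elements ] ([ t ≟ t₀ ] * g t) ≡ g t₀
  ∑-elements-kronecker t₀ g = begin
    ∑[ t ∈ elements ] ([ t ≟ t₀ ] * g t)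
      ≡⟨ ∑-map from (allFin size) _ ⟩
    ∑[ i ∈ allFin size ] ([ from i ≟ t₀ ] * g (from i))
      ≡⟨ ∑-cong (allFin size) (λ i → cong (_* g (from i)) (from≟⇔≟to i)) ⟩
    ∑[ i ∈ allFin size ] ([ i Fin.≟ to t₀ ] * g (from i))
      ≡⟨ ∑-allFin-kronecker (to t₀) (g ∘ from) ⟩
    g (from (to t₀))
      ≡⟨ cong g (Inverse.strictlyInverseʳ enum t₀) ⟩
    g t₀ ∎
    where
    open ≡-Reasoning
    from : Fin size → Carrier
    from = Inverse.from enum
    to : Carrier → Fin size
    to = Inverse.to enum
    from≟⇔≟to : ∀ i → [ from i ≟ t₀ ] ≡ [ i Fin.≟ to t₀ ]
    from≟⇔≟to i = []-⇔ (from i ≟ t₀) (i Fin.≟ to t₀)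
      (λ e → trans (sym (Inverse.strictlyInverseˡ enum i)) (cong to e))
      (λ e → trans (cong from e) (Inverse.strictlyInverseʳ enum t₀))

  ∑-χ-δ : ∀ (u : Carrier → Carrier) → ∑[ t ∈ elements ] χ (u t) ≡ q * ∑[ t ∈ elements ] δ (u t) - q
  ∑-χ-δ u = begin
    ∑[ t ∈ elements ] (q * δ (u t) + ℤ.- 1ℤ)
      ≡⟨ ∑-distrib-+ elements (λ t → q * δ (u t)) (λ _ → ℤ.- 1ℤ) ⟩
    ∑[ t ∈ elements ] (q * δ (u t)) + ∑[ t ∈ elements ] (ℤ.- 1ℤ)
      ≡⟨ cong₂ _+_ (sym (*-distribˡ-∑ q elements (δ ∘ u))) (∑-elements-const (ℤ.- 1ℤ)) ⟩
    q * ∑[ t ∈ elements ] δ (u t) + q * ℤ.- 1ℤ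
      ≡⟨ cong (λ s → q * ∑[ t ∈ elements ] δ (u t) + s) (*-minus-one q) ⟩
    q * ∑[ t ∈ elements ] δ (u t) - q ∎
    where
    open ≡-Reasoning
    *-minus-one : ∀ i → i * ℤ.- 1ℤ ≡ ℤ.- i
    *-minus-one = solve-∀

  module _ (a : Carrier) (a≢0 : a ≢ 0#) (b : Carrier) where

    a⁻¹ : Carrier
    a⁻¹ = inv a a≢0

    root : Carrier
    root = ⊝ b ⊗ a⁻¹

    a⊗a⁻¹≡1 : a ⊗ a⁻¹ ≡ 1#
    a⊗a⁻¹≡1 = proj₂ (inverse a a≢0)

    root-unique : ∀ t → a ⊗ t ⊕ b ≡ 0# → t ≡ root
    root-unique t e = begin
      t
        ≡⟨ solve 4 (λ t a a⁻¹ b → t := (a :* t :+ b) :* a⁻¹ :+ t :* (con (ℤ.+ 1) :- a :* a⁻¹) :- b :* a⁻¹)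
                 refl t a a⁻¹ b ⟩
      (a ⊗ t ⊕ b) ⊗ a⁻¹ ⊕ t ⊗ (1# ⊕ ⊝ (a ⊗ a⁻¹)) ⊕ ⊝ (b ⊗ a⁻¹)
        ≡⟨ cong₂ (λ u v → u ⊗ a⁻¹ ⊕ t ⊗ (1# ⊕ ⊝ v) ⊕ ⊝ (b ⊗ a⁻¹)) e a⊗a⁻¹≡1 ⟩
      0# ⊗ a⁻¹ ⊕ t ⊗ (1# ⊕ ⊝ 1#) ⊕ ⊝ (b ⊗ a⁻¹)
        ≡⟨ solve 3 (λ t a⁻¹ b → con (ℤ.+ 0) :* a⁻¹ :+ t :* (con (ℤ.+ 1) :- con (ℤ.+ 1)) :- b :* a⁻¹ := (:- b) :* a⁻¹)
                 refl t a⁻¹ b ⟩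
      root ∎
      where open ≡-Reasoning

    root-is-root : a ⊗ root ⊕ b ≡ 0#
    root-is-root = begin
      a ⊗ (⊝ b ⊗ a⁻¹) ⊕ b  ≡⟨ solve 3 (λ a a⁻¹ b → a :* ((:- b) :* a⁻¹) :+ b := (:- b) :* (a :* a⁻¹) :+ b)
                                     refl a a⁻¹ b ⟩
      ⊝ b ⊗ (a ⊗ a⁻¹) ⊕ b  ≡⟨ cong (λ u → ⊝ b ⊗ u ⊕ b) a⊗a⁻¹≡1 ⟩
      ⊝ b ⊗ 1# ⊕ b         ≡⟨ solve 1 (λ b → (:- b) :* con (ℤ.+ 1) :+ b := con (ℤ.+ 0)) refl b ⟩
      0#                   ∎
      where open ≡-Reasoning

    ∑-δ-affine : ∀ (g : Carrier → ℤ) → ∑[ t ∈ elements ] (δ (a ⊗ t ⊕ b) * g t) ≡ g root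
    ∑-δ-affine g = trans (∑-cong elements (λ t → cong (_* g t) (δ≡[≟root] t))) (∑-elements-kronecker root g)
      where
      δ≡[≟root] : ∀ t → δ (a ⊗ t ⊕ b) ≡ [ t ≟ root ]
      δ≡[≟root] t = []-⇔ ((a ⊗ t ⊕ b) ≟ 0#) (t ≟ root) (root-unique t) (λ { refl → root-is-root })

  δ-0# : δ 0# ≡ 1ℤ
  δ-0# = [ 0# ≟ 0# ]-yes refl

  δ-≢0 : ∀ {a} → a ≢ 0# → δ a ≡ 0ℤ
  δ-≢0 {a} a≢0 = [ a ≟ 0# ]-no a≢0

  0⊗t⊕b≡b : ∀ t b → 0# ⊗ t ⊕ b ≡ b
  0⊗t⊕b≡b = solve 2 (λ t b → con (ℤ.+ 0) :* t :+ b := b) refl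

  ∑-χ-affine : ∀ a b → ∑[ t ∈ elements ] χ (a ⊗ t ⊕ b) ≡ q * (δ a * χ b)
  ∑-χ-affine a b with a ≟ 0#
  ... | yes refl = begin
    ∑[ t ∈ elements ] χ (0# ⊗ t ⊕ b) ≡⟨ ∑-cong elements (λ t → cong χ (0⊗t⊕b≡b t b)) ⟩
    ∑[ t ∈ elements ] χ b            ≡⟨ ∑-elements-const (χ b) ⟩
    q * χ b                          ≡⟨ cong (q *_) (ℤ.*-identityˡ (χ b)) ⟨
    q * (1ℤ * χ b)                   ≡⟨ cong (λ d → q * (d * χ b)) δ-0# ⟨
    q * (δ 0# * χ b)                 ∎
    where open ≡-Reasoning
  ... | no a≢0 = begin
    ∑[ t ∈ elements ] χ (a ⊗ t ⊕ b)
      ≡⟨ ∑-χ-δ (λ t → a ⊗ t ⊕ b) ⟩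
    q * ∑[ t ∈ elements ] δ (a ⊗ t ⊕ b) - q
      ≡⟨ cong (λ s → q * s - q) (∑-cong elements (λ t → ℤ.*-identityʳ _)) ⟨
    q * ∑[ t ∈ elements ] (δ (a ⊗ t ⊕ b) * 1ℤ) - q
      ≡⟨ cong (λ s → q * s - q) (∑-δ-affine a a≢0 b (λ _ → 1ℤ)) ⟩
    q * 1ℤ - q
      ≡⟨ vanish q (χ b) ⟩
    q * (0ℤ * χ b)
      ≡⟨ cong (λ d → q * (d * χ b)) (δ-≢0 a≢0) ⟨
    q * (δ a * χ b) ∎
    where
    open ≡-Reasoning
    vanish : ∀ q c → q * 1ℤ - q ≡ q * (0ℤ * c)
    vanish = solve-∀

  ∑-χχ-affine : ∀ a (a≢0 : a ≢ 0#) b a′ b′ →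
                ∑[ t ∈ elements ] (χ (a ⊗ t ⊕ b) * χ (a′ ⊗ t ⊕ b′))
                  ≡ (1ℤ - δ a′) * q * χ (a′ ⊗ root a a≢0 b ⊕ b′)
  ∑-χχ-affine a a≢0 b a′ b′ = begin
    ∑[ t ∈ elements ] (χ (a ⊗ t ⊕ b) * χ (a′ ⊗ t ⊕ b′))
      ≡⟨ ∑-cong elements (λ t → split q (δ (a ⊗ t ⊕ b)) (χ (a′ ⊗ t ⊕ b′))) ⟩
    ∑[ t ∈ elements ] (δ (a ⊗ t ⊕ b) * (q * χ (a′ ⊗ t ⊕ b′)) + ℤ.- 1ℤ * χ (a′ ⊗ t ⊕ b′))
      ≡⟨ ∑-distrib-+ elements (λ t → δ (a ⊗ t ⊕ b) * (q * χ (a′ ⊗ t ⊕ b′)))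
                              (λ t → ℤ.- 1ℤ * χ (a′ ⊗ t ⊕ b′)) ⟩
    ∑[ t ∈ elements ] (δ (a ⊗ t ⊕ b) * (q * χ (a′ ⊗ t ⊕ b′)))
      + ∑[ t ∈ elements ] (ℤ.- 1ℤ * χ (a′ ⊗ t ⊕ b′))
      ≡⟨ cong₂ _+_ (∑-δ-affine a a≢0 b (λ t → q * χ (a′ ⊗ t ⊕ b′)))
                   (trans (sym (*-distribˡ-∑ (ℤ.- 1ℤ) elements (λ t → χ (a′ ⊗ t ⊕ b′))))
                          (cong (ℤ.- 1ℤ *_) (∑-χ-affine a′ b′))) ⟩
    q * χ (a′ ⊗ r ⊕ b′) + ℤ.- 1ℤ * (q * (δ a′ * χ b′))
      ≡⟨ by-cases (a′ ≟ 0#) ⟩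
    (1ℤ - δ a′) * q * χ (a′ ⊗ r ⊕ b′) ∎
    where
    open ≡-Reasoning
    r : Carrier
    r = root a a≢0 b

    split : ∀ q d c → (q * d - 1ℤ) * c ≡ d * (q * c) + ℤ.- 1ℤ * c
    split = solve-∀

    by-cases : Dec (a′ ≡ 0#) →
               q * χ (a′ ⊗ r ⊕ b′) + ℤ.- 1ℤ * (q * (δ a′ * χ b′)) ≡ (1ℤ - δ a′) * q * χ (a′ ⊗ r ⊕ b′)
    by-cases (yes refl) = begin
      q * χ (0# ⊗ r ⊕ b′) + ℤ.- 1ℤ * (q * (δ 0# * χ b′))
        ≡⟨ cong₂ (λ c d → q * χ c + ℤ.- 1ℤ * (q * (d * χ b′))) (0⊗t⊕b≡b r b′) δ-0# ⟩
      q * χ b′ + ℤ.- 1ℤ * (q * (1ℤ * χ b′))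
        ≡⟨ cancel q (χ b′) ⟩
      (1ℤ - 1ℤ) * q * χ b′
        ≡⟨ cong₂ (λ c d → (1ℤ - d) * q * χ c) (0⊗t⊕b≡b r b′) δ-0# ⟨
      (1ℤ - δ 0#) * q * χ (0# ⊗ r ⊕ b′) ∎
      where
      cancel : ∀ q c → q * c + ℤ.- 1ℤ * (q * (1ℤ * c)) ≡ (1ℤ - 1ℤ) * q * c
      cancel = solve-∀
    by-cases (no a′≢0) = begin
      q * χ (a′ ⊗ r ⊕ b′) + ℤ.- 1ℤ * (q * (δ a′ * χ b′))
        ≡⟨ cong (λ d → q * χ (a′ ⊗ r ⊕ b′) + ℤ.- 1ℤ * (q * (d * χ b′))) (δ-≢0 a′≢0) ⟩
      q * χ (a′ ⊗ r ⊕ b′) + ℤ.- 1ℤ * (q * (0ℤ * χ b′))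
        ≡⟨ drop q (χ (a′ ⊗ r ⊕ b′)) (χ b′) ⟩
      (1ℤ - 0ℤ) * q * χ (a′ ⊗ r ⊕ b′)
        ≡⟨ cong (λ d → (1ℤ - d) * q * χ (a′ ⊗ r ⊕ b′)) (δ-≢0 a′≢0) ⟨
      (1ℤ - δ a′) * q * χ (a′ ⊗ r ⊕ b′) ∎
      where
      drop : ∀ q x c → q * x + ℤ.- 1ℤ * (q * (0ℤ * c)) ≡ (1ℤ - 0ℤ) * q * x
      drop = solve-∀

  ∑-χχ-constant : ∀ b a′ b′ →
                  ∑[ t ∈ elements ] (χ (0# ⊗ t ⊕ b) * χ (a′ ⊗ t ⊕ b′)) ≡ q * δ a′ * (χ b * χ b′)
  ∑-χχ-constant b a′ b′ = begin
    ∑[ t ∈ elements ] (χ (0# ⊗ t ⊕ b) * χ (a′ ⊗ t ⊕ b′))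
      ≡⟨ ∑-cong elements (λ t → cong (λ s → χ s * χ (a′ ⊗ t ⊕ b′)) (0⊗t⊕b≡b t b)) ⟩
    ∑[ t ∈ elements ] (χ b * χ (a′ ⊗ t ⊕ b′))
      ≡⟨ *-distribˡ-∑ (χ b) elements (λ t → χ (a′ ⊗ t ⊕ b′)) ⟨
    χ b * ∑[ t ∈ elements ] χ (a′ ⊗ t ⊕ b′)
      ≡⟨ cong (χ b *_) (∑-χ-affine a′ b′) ⟩
    χ b * (q * (δ a′ * χ b′))
      ≡⟨ regroup q (δ a′) (χ b) (χ b′) ⟩
    q * δ a′ * (χ b * χ b′) ∎
    where
    open ≡-Reasoning
    regroup : ∀ q d x y → x * (q * (d * y)) ≡ q * d * (x * y)
    regroup = solve-∀

  0≤q : 0ℤ ≤ q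
  0≤q = +≤+ ℕ.z≤n

  1≤q : 1ℤ ≤ q
  1≤q = +≤+ (ℕ.>-nonZero⁻¹ size {{Fin.nonZeroIndex (Inverse.to enum 0#)}})

  0≤q^n : ∀ n → 0ℤ ≤ q ^ n
  0≤q^n n = subst (0ℤ ≤_) (pos-^ size n) (+≤+ ℕ.z≤n)

  0≤δ : ∀ t → 0ℤ ≤ δ t
  0≤δ t = 0≤𝟙 (does (t ≟ 0#))

  0≤1-δ : ∀ t → 0ℤ ≤ 1ℤ - δ t
  0≤1-δ t = ℤ.i≤j⇒0≤j-i (𝟙≤1 (does (t ≟ 0#)))

  χ-0# : χ 0# ≡ q - 1ℤ
  χ-0# = trans (cong (λ d → q * d - 1ℤ) δ-0#) (cong (_- 1ℤ) (ℤ.*-identityʳ q))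

  0≤χ-0# : 0ℤ ≤ χ 0#
  0≤χ-0# = subst (0ℤ ≤_) (sym χ-0#) (ℤ.i≤j⇒0≤j-i 1≤q)

  vectors : ∀ n → List (Vec Carrier n)
  vectors zero    = [] ∷ []
  vectors (suc n) = concatMap (λ t → map (t ∷_) (vectors n)) elements

  ∑-vectors-suc : ∀ n (f : Vec Carrier (suc n) → ℤ) →
                  ∑ (vectors (suc n)) f ≡ ∑[ t ∈ elements ] ∑[ v ∈ vectors n ] f (t ∷ v)
  ∑-vectors-suc n f = trans (∑-concatMap (λ t → map (t ∷_) (vectors n)) elements f)
                            (∑-cong elements (λ t → ∑-map (t ∷_) (vectors n) f))

  infix 8 _·_
  _·_ : ∀ {n} → Vec Carrier n → Vec Carrier n → Carrier
  []       · []       = 0#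
  (k ∷ ks) · (v ∷ vs) = k ⊗ v ⊕ ks · vs

  δⁿ : ∀ {n} → Vec Carrier n → ℤ
  δⁿ []       = 1ℤ
  δⁿ (k ∷ ks) = δ k * δⁿ ks

  0≤δⁿ : ∀ {n} (k : Vec Carrier n) → 0ℤ ≤ δⁿ k
  0≤δⁿ []       = +≤+ ℕ.z≤n
  0≤δⁿ (k ∷ ks) = 0≤i*j (0≤δ k) (0≤δⁿ ks)

  ∑-χ-affineⁿ : ∀ n (k : Vec Carrier n) b → ∑[ v ∈ vectors n ] χ (k · v ⊕ b) ≡ q ^ n * (δⁿ k * χ b)
  ∑-χ-affineⁿ zero    []       b = begin
    χ (0# ⊕ b) + 0ℤ    ≡⟨ ℤ.+-identityʳ _ ⟩
    χ (0# ⊕ b)         ≡⟨ cong χ (solve 1 (λ b → con (ℤ.+ 0) :+ b := b) refl b) ⟩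
    χ b                ≡⟨ trans (ℤ.*-identityˡ _) (ℤ.*-identityˡ _) ⟨
    1ℤ * (1ℤ * χ b)    ∎
    where open ≡-Reasoning
  ∑-χ-affineⁿ (suc n) (k₀ ∷ k) b = begin
    ∑ (vectors (suc n)) (λ v → χ ((k₀ ∷ k) · v ⊕ b))
      ≡⟨ ∑-vectors-suc n (λ v → χ ((k₀ ∷ k) · v ⊕ b)) ⟩
    ∑[ t ∈ elements ] ∑[ v ∈ vectors n ] χ (k₀ ⊗ t ⊕ k · v ⊕ b)
      ≡⟨ ∑-cong elements (λ t → ∑-cong (vectors n) (λ v → cong χ (shift k₀ t (k · v) b))) ⟩
    ∑[ t ∈ elements ] ∑[ v ∈ vectors n ] χ (k · v ⊕ (k₀ ⊗ t ⊕ b))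
      ≡⟨ ∑-cong elements (λ t → trans (∑-χ-affineⁿ n k (k₀ ⊗ t ⊕ b)) (sym (ℤ.*-assoc (q ^ n) (δⁿ k) _))) ⟩
    ∑[ t ∈ elements ] (q ^ n * δⁿ k * χ (k₀ ⊗ t ⊕ b))
      ≡⟨ *-distribˡ-∑ (q ^ n * δⁿ k) elements (λ t → χ (k₀ ⊗ t ⊕ b)) ⟨
    q ^ n * δⁿ k * ∑[ t ∈ elements ] χ (k₀ ⊗ t ⊕ b)
      ≡⟨ cong (q ^ n * δⁿ k *_) (∑-χ-affine k₀ b) ⟩
    q ^ n * δⁿ k * (q * (δ k₀ * χ b))
      ≡⟨ regroup q (q ^ n) (δ k₀) (δⁿ k) (χ b) ⟩
    q * q ^ n * (δ k₀ * δⁿ k * χ b) ∎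
    where
    open ≡-Reasoning
    shift : ∀ k₀ t s b → k₀ ⊗ t ⊕ s ⊕ b ≡ s ⊕ (k₀ ⊗ t ⊕ b)
    shift = solve 4 (λ k₀ t s b → k₀ :* t :+ s :+ b := s :+ (k₀ :* t :+ b)) refl
    regroup : ∀ q Q d D c → Q * D * (q * (d * c)) ≡ q * Q * (d * D * c)
    regroup = solve-∀

  ∑-χ-linearⁿ : ∀ n (k : Vec Carrier n) → ∑[ v ∈ vectors n ] χ (k · v) ≡ q ^ n * (δⁿ k * χ 0#)
  ∑-χ-linearⁿ n k = trans (∑-cong (vectors n) (λ v → cong χ (solve 1 (λ s → s := s :+ con (ℤ.+ 0)) refl (k · v))))
                          (∑-χ-affineⁿ n k 0#)

  0≤∑-χ-linearⁿ : ∀ n (k : Vec Carrier n) → 0ℤ ≤ ∑[ v ∈ vectors n ] χ (k · v)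
  0≤∑-χ-linearⁿ n k = subst (0ℤ ≤_) (sym (∑-χ-linearⁿ n k)) (0≤i*j (0≤q^n n) (0≤i*j (0≤δⁿ k) 0≤χ-0#))

  ·-linear : ∀ {n} c (k m v : Vec Carrier n) → c ⊗ k · v ⊕ m · v ≡ zipWith (λ kᵢ mᵢ → c ⊗ kᵢ ⊕ mᵢ) k m · v
  ·-linear c []       []       []       = solve 1 (λ c → c :* con (ℤ.+ 0) :+ con (ℤ.+ 0) := con (ℤ.+ 0)) refl c
  ·-linear c (k₀ ∷ k) (m₀ ∷ m) (v₀ ∷ v) =
    trans (solve 6 (λ c k₀ m₀ v₀ s s′ → c :* (k₀ :* v₀ :+ s) :+ (m₀ :* v₀ :+ s′)
                                     := (c :* k₀ :+ m₀) :* v₀ :+ (c :* s :+ s′))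
                   refl c k₀ m₀ v₀ (k · v) (m · v))
          (cong ((c ⊗ k₀ ⊕ m₀) ⊗ v₀ ⊕_) (·-linear c k m v))

  eliminate : ∀ {n} a → a ≢ 0# → Carrier → Vec Carrier n → Vec Carrier n → Vec Carrier n
  eliminate a a≢0 a′ = zipWith (λ kᵢ mᵢ → ⊝ (a′ ⊗ inv a a≢0) ⊗ kᵢ ⊕ mᵢ)

  ·-eliminate : ∀ {n} a (a≢0 : a ≢ 0#) a′ (k m v : Vec Carrier n) →
                a′ ⊗ root a a≢0 (k · v) ⊕ m · v ≡ eliminate a a≢0 a′ k m · v
  ·-eliminate a a≢0 a′ k m v =
    trans (solve 4 (λ a′ s a⁻¹ s′ → a′ :* ((:- s) :* a⁻¹) :+ s′ := (:- (a′ :* a⁻¹)) :* s :+ s′)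
                   refl a′ (k · v) (inv a a≢0) (m · v))
          (·-linear (⊝ (a′ ⊗ inv a a≢0)) k m v)

  0≤∑-χχⁿ : ∀ n (k m : Vec Carrier n) → 0ℤ ≤ ∑[ v ∈ vectors n ] (χ (k · v) * χ (m · v))
  0≤∑-χχⁿ zero    []       []       = ∑-nonneg (vectors 0) {λ v → χ ([] · v) * χ ([] · v)} (λ { [] → 0≤i*i (χ 0#) })
  0≤∑-χχⁿ (suc n) (k₀ ∷ k) (m₀ ∷ m) = subst (0ℤ ≤_) (sym reorder) (by-cases (k₀ ≟ 0#))
    where
    inner : Vec Carrier n → ℤ
    inner v = ∑[ t ∈ elements ] (χ (k₀ ⊗ t ⊕ k · v) * χ (m₀ ⊗ t ⊕ m · v))

    reorder : ∑ (vectors (suc n)) (λ v → χ ((k₀ ∷ k) · v) * χ ((m₀ ∷ m) · v)) ≡ ∑ (vectors n) inner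
    reorder = trans (∑-vectors-suc n (λ v → χ ((k₀ ∷ k) · v) * χ ((m₀ ∷ m) · v))) (∑-comm elements (vectors n) _)

    pull-out : ∀ c {f : Vec Carrier n → ℤ} → (∀ v → inner v ≡ c * f v) → ∑ (vectors n) inner ≡ c * ∑ (vectors n) f
    pull-out c inner≡ = trans (∑-cong (vectors n) inner≡) (sym (*-distribˡ-∑ c (vectors n) _))

    by-cases : Dec (k₀ ≡ 0#) → 0ℤ ≤ ∑ (vectors n) inner
    by-cases (yes refl) =
      subst (0ℤ ≤_) (sym (pull-out (q * δ m₀) (λ v → ∑-χχ-constant (k · v) m₀ (m · v))))
            (0≤i*j (0≤i*j 0≤q (0≤δ m₀)) (0≤∑-χχⁿ n k m))
    by-cases (no k₀≢0) =
      subst (0ℤ ≤_) (sym (pull-out ((1ℤ - δ m₀) * q) inner≡))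
            (0≤i*j (0≤i*j (0≤1-δ m₀) 0≤q) (0≤∑-χ-linearⁿ n (eliminate k₀ k₀≢0 m₀ k m)))
      where
      inner≡ : ∀ v → inner v ≡ (1ℤ - δ m₀) * q * χ (eliminate k₀ k₀≢0 m₀ k m · v)
      inner≡ v = trans (∑-χχ-affine k₀ k₀≢0 (k · v) m₀ (m · v))
                       (cong (λ s → (1ℤ - δ m₀) * q * χ s) (·-eliminate k₀ k₀≢0 m₀ k m v))

  ∑-δⁿ-kronecker : ∀ n (g : Vec Carrier n → ℤ) → ∑[ v ∈ vectors n ] (δⁿ v * g v) ≡ g (replicate n 0#)
  ∑-δⁿ-kronecker zero    g = trans (ℤ.+-identityʳ _) (ℤ.*-identityˡ (g []))
  ∑-δⁿ-kronecker (suc n) g = begin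
    ∑ (vectors (suc n)) (λ v → δⁿ v * g v)
      ≡⟨ ∑-vectors-suc n (λ v → δⁿ v * g v) ⟩
    ∑[ t ∈ elements ] ∑[ v ∈ vectors n ] (δ t * δⁿ v * g (t ∷ v))
      ≡⟨ ∑-cong elements (λ t → trans (∑-cong (vectors n) (λ v → ℤ.*-assoc (δ t) (δⁿ v) _))
                                      (sym (*-distribˡ-∑ (δ t) (vectors n) (λ v → δⁿ v * g (t ∷ v))))) ⟩
    ∑[ t ∈ elements ] (δ t * ∑[ v ∈ vectors n ] (δⁿ v * g (t ∷ v)))
      ≡⟨ ∑-cong elements (λ t → cong (δ t *_) (∑-δⁿ-kronecker n (g ∘ (t ∷_)))) ⟩
    ∑[ t ∈ elements ] (δ t * g (t ∷ replicate n 0#))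
      ≡⟨ ∑-elements-kronecker 0# (λ t → g (t ∷ replicate n 0#)) ⟩
    g (0# ∷ replicate n 0#) ∎
    where open ≡-Reasoning

  ·-zeroʳ : ∀ {n} (k : Vec Carrier n) → k · replicate n 0# ≡ 0#
  ·-zeroʳ []       = refl
  ·-zeroʳ (k₀ ∷ k) = trans (cong (k₀ ⊗ 0# ⊕_) (·-zeroʳ k))
                           (solve 1 (λ k₀ → k₀ :* con (ℤ.+ 0) :+ con (ℤ.+ 0) := con (ℤ.+ 0)) refl k₀)

  toM₂ : Vec Carrier 4 → M₂
  toM₂ (a ∷ b ∷ c ∷ d ∷ []) = a , b , c , d

  σ : M₂ → Vec Carrier 4
  σ (x₁ , x₂ , x₃ , x₄) = x₄ ∷ ⊝ x₃ ∷ ⊝ x₂ ∷ x₁ ∷ []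

  ⊙-as-· : ∀ x v → x ⊙ toM₂ v ≡ σ x · v
  ⊙-as-· (x₁ , x₂ , x₃ , x₄) (a ∷ b ∷ c ∷ d ∷ []) =
    solve 8 (λ x₁ x₂ x₃ x₄ a b c d → x₁ :* d :- x₂ :* c :- x₃ :* b :+ x₄ :* a
                                   := x₄ :* a :+ ((:- x₃) :* b :+ ((:- x₂) :* c :+ (x₁ :* d :+ con (ℤ.+ 0)))))
            refl x₁ x₂ x₃ x₄ a b c d

  ⊙-comm : ∀ x y → x ⊙ y ≡ y ⊙ x
  ⊙-comm (x₁ , x₂ , x₃ , x₄) (y₁ , y₂ , y₃ , y₄) =
    solve 8 (λ x₁ x₂ x₃ x₄ y₁ y₂ y₃ y₄ → x₁ :* y₄ :- x₂ :* y₃ :- x₃ :* y₂ :+ x₄ :* y₁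
                                       := y₁ :* x₄ :- y₂ :* x₃ :- y₃ :* x₂ :+ y₄ :* x₁)
            refl x₁ x₂ x₃ x₄ y₁ y₂ y₃ y₄

  ∑-allM₂ : ∀ (f : M₂ → ℤ) → ∑ allM₂ f ≡ ∑[ v ∈ vectors 4 ] f (toM₂ v)
  ∑-allM₂ f = trans nest-allM₂ (sym nest-vectors)
    where
    ∑⁴ : ℤ
    ∑⁴ = ∑[ a ∈ elements ] ∑[ b ∈ elements ] ∑[ c ∈ elements ] ∑[ d ∈ elements ] f (a , b , c , d)
    nest-allM₂ : ∑ allM₂ f ≡ ∑⁴
    nest-allM₂ =
      trans (∑-concatMap _ elements f) (∑-cong elements (λ a →
      trans (∑-concatMap _ elements f) (∑-cong elements (λ b →
      trans (∑-concatMap _ elements f) (∑-cong elements (λ c →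
      ∑-map (λ d → a , b , c , d) elements f))))))
    nest-vectors : ∑[ v ∈ vectors 4 ] f (toM₂ v) ≡ ∑⁴
    nest-vectors =
      trans (∑-vectors-suc 3 (f ∘ toM₂)) (∑-cong elements (λ a →
      trans (∑-vectors-suc 2 _) (∑-cong elements (λ b →
      trans (∑-vectors-suc 1 _) (∑-cong elements (λ c →
      trans (∑-vectors-suc 0 _) (∑-cong elements (λ d → ℤ.+-identityʳ _))))))))

  δ-⊝ : ∀ t → δ (⊝ t) ≡ δ t
  δ-⊝ t = []-⇔ ((⊝ t) ≟ 0#) (t ≟ 0#)
    (λ e → trans (⊝⊝ t) (trans (cong ⊝_ e) ⊝0))
    (λ e → trans (cong ⊝_ e) ⊝0)
    where
    ⊝⊝ : ∀ t → t ≡ ⊝ (⊝ t)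
    ⊝⊝ = solve 1 (λ t → t := :- (:- t)) refl
    ⊝0 : ⊝ 0# ≡ 0#
    ⊝0 = solve 0 (:- con (ℤ.+ 0) := con (ℤ.+ 0)) refl

  δⁿ-σ : ∀ v → δⁿ (σ (toM₂ v)) ≡ δⁿ v
  δⁿ-σ (a ∷ b ∷ c ∷ d ∷ []) = trans (cong₂ (λ δc δb → δ d * (δc * (δb * (δ a * 1ℤ)))) (δ-⊝ c) (δ-⊝ b))
                                    (reverse (δ a) (δ b) (δ c) (δ d))
    where
    reverse : ∀ a b c d → d * (c * (b * (a * 1ℤ))) ≡ a * (b * (c * (d * 1ℤ)))
    reverse = solve-∀

  G : M₂ → M₂ → ℤ
  G x x′ = ∑[ y ∈ allM₂ ] (χ (x ⊙ y) * χ (x′ ⊙ y))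

  0≤G : ∀ x x′ → 0ℤ ≤ G x x′
  0≤G x x′ = subst (0ℤ ≤_) (sym G≡) (0≤∑-χχⁿ 4 (σ x) (σ x′))
    where
    G≡ : G x x′ ≡ ∑[ v ∈ vectors 4 ] (χ (σ x · v) * χ (σ x′ · v))
    G≡ = trans (∑-allM₂ (λ y → χ (x ⊙ y) * χ (x′ ⊙ y)))
               (∑-cong (vectors 4) (λ v → cong₂ (λ s s′ → χ s * χ s′) (⊙-as-· x v) (⊙-as-· x′ v)))

  ∑-χ-⊙ : ∀ y → ∑[ x ∈ allM₂ ] χ (x ⊙ y) ≡ q ^ 4 * (δⁿ (σ y) * χ 0#)
  ∑-χ-⊙ y = begin
    ∑[ x ∈ allM₂ ] χ (x ⊙ y)                ≡⟨ ∑-cong allM₂ (λ x → cong χ (⊙-comm x y)) ⟩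
    ∑[ x ∈ allM₂ ] χ (y ⊙ x)                ≡⟨ ∑-allM₂ (λ x → χ (y ⊙ x)) ⟩
    ∑[ v ∈ vectors 4 ] χ (y ⊙ toM₂ v)       ≡⟨ ∑-cong (vectors 4) (λ v → cong χ (⊙-as-· y v)) ⟩
    ∑[ v ∈ vectors 4 ] χ (σ y · v)          ≡⟨ ∑-χ-linearⁿ 4 (σ y) ⟩
    q ^ 4 * (δⁿ (σ y) * χ 0#)               ∎
    where open ≡-Reasoning

  ∑-G : ∀ x → ∑[ x′ ∈ allM₂ ] G x x′ ≡ q ^ 4 * (χ 0# * χ 0#)
  ∑-G x = begin
    ∑[ x′ ∈ allM₂ ] ∑[ y ∈ allM₂ ] (χ (x ⊙ y) * χ (x′ ⊙ y))
      ≡⟨ ∑-comm allM₂ allM₂ _ ⟩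
    ∑[ y ∈ allM₂ ] ∑[ x′ ∈ allM₂ ] (χ (x ⊙ y) * χ (x′ ⊙ y))
      ≡⟨ ∑-cong allM₂ (λ y → trans (sym (*-distribˡ-∑ (χ (x ⊙ y)) allM₂ (λ x′ → χ (x′ ⊙ y))))
                                   (cong (χ (x ⊙ y) *_) (∑-χ-⊙ y))) ⟩
    ∑[ y ∈ allM₂ ] (χ (x ⊙ y) * (q ^ 4 * (δⁿ (σ y) * χ 0#)))
      ≡⟨ ∑-allM₂ _ ⟩
    ∑[ v ∈ vectors 4 ] (χ (x ⊙ toM₂ v) * (q ^ 4 * (δⁿ (σ (toM₂ v)) * χ 0#)))
      ≡⟨ ∑-cong (vectors 4) (λ v → trans (cong₂ (λ s d → χ s * (q ^ 4 * (d * χ 0#))) (⊙-as-· x v) (δⁿ-σ v))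
                                         (regroup (q ^ 4) (χ 0#) (δⁿ v) (χ (σ x · v)))) ⟩
    ∑[ v ∈ vectors 4 ] (δⁿ v * (q ^ 4 * χ 0# * χ (σ x · v)))
      ≡⟨ ∑-δⁿ-kronecker 4 (λ v → q ^ 4 * χ 0# * χ (σ x · v)) ⟩
    q ^ 4 * χ 0# * χ (σ x · replicate 4 0#)
      ≡⟨ cong (λ s → q ^ 4 * χ 0# * χ s) (·-zeroʳ (σ x)) ⟩
    q ^ 4 * χ 0# * χ 0#
      ≡⟨ ℤ.*-assoc (q ^ 4) (χ 0#) (χ 0#) ⟩
    q ^ 4 * (χ 0# * χ 0#) ∎
    where
    open ≡-Reasoning
    regroup : ∀ Q c d x → x * (Q * (d * c)) ≡ d * (Q * c * x)
    regroup = solve-∀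

  card-as-∑ : ∀ (E : Subset) → ℤ.+ card E ≡ ∑[ x ∈ allM₂ ] 𝟙 (E x)
  card-as-∑ E = length-filter-𝟙 E _ allM₂

  W-as-∑ : ∀ (E F : Subset) → ℤ.+ W 0# E F ≡ ∑[ x ∈ allM₂ ] ∑[ y ∈ allM₂ ] (𝟙 (E x) * (𝟙 (F y) * δ (x ⊙ y)))
  W-as-∑ E F = length-filter-pairs E F (λ x y → (x ⊙ y) ≟ 0#) _ allM₂ allM₂

  q⁴χ0²≤2q⁶ : q ^ 4 * (χ 0# * χ 0#) ≤ ℤ.+ 2 * q ^ 6
  q⁴χ0²≤2q⁶ = ℤ.0≤i-j⇒j≤i (subst (0ℤ ≤_) (sym (trans (cong (λ c → ℤ.+ 2 * q ^ 6 - q ^ 4 * (c * c)) χ-0#) (gap q)))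
                                         0≤rhs)
    where
    gap : ∀ q → ℤ.+ 2 * (q * (q * (q * (q * (q * (q * 1ℤ)))))) - q * (q * (q * (q * 1ℤ))) * ((q - 1ℤ) * (q - 1ℤ))
              ≡ q * (q * (q * (q * 1ℤ))) * ((q - 1ℤ) * (q - 1ℤ) + ℤ.+ 4 * (q - 1ℤ) + ℤ.+ 2)
    gap = solve-∀
    0≤q-1 : 0ℤ ≤ q - 1ℤ
    0≤q-1 = ℤ.i≤j⇒0≤j-i 1≤q
    0≤rhs : 0ℤ ≤ q ^ 4 * ((q - 1ℤ) * (q - 1ℤ) + ℤ.+ 4 * (q - 1ℤ) + ℤ.+ 2)
    0≤rhs = 0≤i*j (0≤q^n 4)
                  (ℤ.+-mono-≤ (ℤ.+-mono-≤ (0≤i*i (q - 1ℤ)) (0≤i*j {ℤ.+ 4} (+≤+ ℕ.z≤n) 0≤q-1)) (+≤+ ℕ.z≤n))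

  module _ (E F : Subset) where

    e f : M₂ → ℤ
    e x = 𝟙 (E x)
    f y = 𝟙 (F y)

    D : M₂ → ℤ
    D y = ∑[ x ∈ allM₂ ] (e x * χ (x ⊙ y))

    deviation : ℤ
    deviation = q * ℤ.+ W 0# E F - ℤ.+ card E * ℤ.+ card F

    ∑-F-D : ∑[ y ∈ allM₂ ] (f y * D y) ≡ deviation
    ∑-F-D = begin
      ∑[ y ∈ allM₂ ] (f y * D y)
        ≡⟨ ∑-cong allM₂ (λ y → *-distribˡ-∑ (f y) allM₂ (λ x → e x * χ (x ⊙ y))) ⟩
      ∑[ y ∈ allM₂ ] ∑[ x ∈ allM₂ ] (f y * (e x * χ (x ⊙ y)))
        ≡⟨ ∑-comm allM₂ allM₂ _ ⟩
      ∑[ x ∈ allM₂ ] ∑[ y ∈ allM₂ ] (f y * (e x * χ (x ⊙ y)))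
        ≡⟨ ∑-cong allM₂ (λ x → ∑-cong allM₂ (λ y → split q (e x) (f y) (δ (x ⊙ y)))) ⟩
      ∑[ x ∈ allM₂ ] ∑[ y ∈ allM₂ ] (q * w₀ x y + ℤ.- 1ℤ * e x * f y)
        ≡⟨ ∑∑-distrib-+ allM₂ allM₂ (λ x y → q * w₀ x y) (λ x y → ℤ.- 1ℤ * e x * f y) ⟩
      ∑[ x ∈ allM₂ ] ∑[ y ∈ allM₂ ] (q * w₀ x y) + ∑[ x ∈ allM₂ ] ∑[ y ∈ allM₂ ] (ℤ.- 1ℤ * e x * f y)
        ≡⟨ cong₂ _+_ (trans (∑-cong allM₂ (λ x → sym (*-distribˡ-∑ q allM₂ (w₀ x))))
                            (sym (*-distribˡ-∑ q allM₂ _)))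
                     (∑∑-product allM₂ allM₂ (λ x → ℤ.- 1ℤ * e x) f) ⟩
      q * ∑[ x ∈ allM₂ ] ∑[ y ∈ allM₂ ] w₀ x y + ∑[ x ∈ allM₂ ] (ℤ.- 1ℤ * e x) * ∑ allM₂ f
        ≡⟨ cong₂ (λ w s → q * w + s * ∑ allM₂ f) (sym (W-as-∑ E F)) (sym (*-distribˡ-∑ (ℤ.- 1ℤ) allM₂ e)) ⟩
      q * ℤ.+ W 0# E F + ℤ.- 1ℤ * ∑ allM₂ e * ∑ allM₂ f
        ≡⟨ cong₂ (λ cE cF → q * ℤ.+ W 0# E F + ℤ.- 1ℤ * cE * cF) (sym (card-as-∑ E)) (sym (card-as-∑ F)) ⟩
      q * ℤ.+ W 0# E F + ℤ.- 1ℤ * ℤ.+ card E * ℤ.+ card F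
        ≡⟨ tidy (q * ℤ.+ W 0# E F) (ℤ.+ card E) (ℤ.+ card F) ⟩
      deviation ∎
      where
      open ≡-Reasoning
      w₀ : M₂ → M₂ → ℤ
      w₀ x y = e x * (f y * δ (x ⊙ y))
      split : ∀ q e f d → f * (e * (q * d - 1ℤ)) ≡ q * (e * (f * d)) + ℤ.- 1ℤ * e * f
      split = solve-∀
      tidy : ∀ w e f → w + ℤ.- 1ℤ * e * f ≡ w - e * f
      tidy = solve-∀

    ∑-D² : ∑[ y ∈ allM₂ ] (D y * D y) ≤ ℤ.+ card E * (q ^ 4 * (χ 0# * χ 0#))
    ∑-D² = begin
      ∑[ y ∈ allM₂ ] (D y * D y)
        ≡⟨ ∑-square-∑ allM₂ allM₂ (λ x y → e x * χ (x ⊙ y)) ⟩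
      ∑[ x ∈ allM₂ ] ∑[ x′ ∈ allM₂ ] ∑[ y ∈ allM₂ ] (e x * χ (x ⊙ y) * (e x′ * χ (x′ ⊙ y)))
        ≡⟨ ∑-cong allM₂ (λ x → ∑-cong allM₂ (λ x′ → pull-out x x′)) ⟩
      ∑[ x ∈ allM₂ ] ∑[ x′ ∈ allM₂ ] (e x * (e x′ * G x x′))
        ≤⟨ ∑-mono-≤ allM₂ (λ x → ∑-mono-≤ allM₂ (λ x′ → 𝟙*-mono (E x) (𝟙*≤ (E x′) (0≤G x x′)))) ⟩
      ∑[ x ∈ allM₂ ] ∑[ x′ ∈ allM₂ ] (e x * G x x′)
        ≡⟨ ∑-cong allM₂ (λ x → trans (sym (*-distribˡ-∑ (e x) allM₂ (G x))) (cong (e x *_) (∑-G x))) ⟩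
      ∑[ x ∈ allM₂ ] (e x * (q ^ 4 * (χ 0# * χ 0#)))
        ≡⟨ *-distribʳ-∑ (q ^ 4 * (χ 0# * χ 0#)) allM₂ e ⟨
      ∑ allM₂ e * (q ^ 4 * (χ 0# * χ 0#))
        ≡⟨ cong (_* (q ^ 4 * (χ 0# * χ 0#))) (card-as-∑ E) ⟨
      ℤ.+ card E * (q ^ 4 * (χ 0# * χ 0#)) ∎
      where
      open ℤ.≤-Reasoning
      regroup : ∀ a c a′ c′ → a * c * (a′ * c′) ≡ a * (a′ * (c * c′))
      regroup = solve-∀
      pull-out : ∀ x x′ → ∑[ y ∈ allM₂ ] (e x * χ (x ⊙ y) * (e x′ * χ (x′ ⊙ y))) ≡ e x * (e x′ * G x x′)
      pull-out x x′ = Eq.begin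
        ∑[ y ∈ allM₂ ] (e x * χ (x ⊙ y) * (e x′ * χ (x′ ⊙ y)))
          Eq.≡⟨ ∑-cong allM₂ (λ y → regroup (e x) (χ (x ⊙ y)) (e x′) (χ (x′ ⊙ y))) ⟩
        ∑[ y ∈ allM₂ ] (e x * (e x′ * (χ (x ⊙ y) * χ (x′ ⊙ y))))
          Eq.≡⟨ *-distribˡ-∑ (e x) allM₂ _ ⟨
        e x * ∑[ y ∈ allM₂ ] (e x′ * (χ (x ⊙ y) * χ (x′ ⊙ y)))
          Eq.≡⟨ cong (e x *_) (*-distribˡ-∑ (e x′) allM₂ (λ y → χ (x ⊙ y) * χ (x′ ⊙ y))) ⟨
        e x * (e x′ * G x x′) Eq.∎
        where module Eq = ≡-Reasoning

    deviation²≤ : deviation * deviation ≤ ℤ.+ card F * (ℤ.+ card E * (q ^ 4 * (χ 0# * χ 0#)))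
    deviation²≤ = begin
      deviation * deviation
        ≡⟨ cong₂ _*_ ∑-F-D ∑-F-D ⟨
      (∑[ y ∈ allM₂ ] (f y * D y)) * (∑[ y ∈ allM₂ ] (f y * D y))
        ≤⟨ ∑-cauchy-schwarz allM₂ f D (λ y → 0≤𝟙 (F y)) ⟩
      ∑ allM₂ f * ∑[ y ∈ allM₂ ] (f y * (D y * D y))
        ≤⟨ ℤ.*-monoˡ-≤-nonNeg _ {{ℤ.nonNegative (∑-nonneg allM₂ (λ y → 0≤𝟙 (F y)))}}
             (ℤ.≤-trans (∑-mono-≤ allM₂ (λ y → 𝟙*≤ (F y) (0≤i*i (D y)))) ∑-D²) ⟩
      ∑ allM₂ f * (ℤ.+ card E * (q ^ 4 * (χ 0# * χ 0#)))
        ≡⟨ cong (_* (ℤ.+ card E * (q ^ 4 * (χ 0# * χ 0#)))) (card-as-∑ F) ⟨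
      ℤ.+ card F * (ℤ.+ card E * (q ^ 4 * (χ 0# * χ 0#))) ∎
      where open ℤ.≤-Reasoning

    deviation-bound :
      (ℤ.+ (size ℕ.* W 0# E F) - ℤ.+ (card E ℕ.* card F)) * (ℤ.+ (size ℕ.* W 0# E F) - ℤ.+ (card E ℕ.* card F))
        ≤ ℤ.+ (2 ℕ.* size ℕ.^ 6 ℕ.* (card E ℕ.* card F))
    deviation-bound = begin
      (ℤ.+ (size ℕ.* W 0# E F) - ℤ.+ (card E ℕ.* card F)) * (ℤ.+ (size ℕ.* W 0# E F) - ℤ.+ (card E ℕ.* card F))
        ≡⟨ cong (λ d → d * d) (cong₂ _-_ (ℤ.pos-* size (W 0# E F)) (ℤ.pos-* (card E) (card F))) ⟩
      deviation * deviation
        ≤⟨ deviation²≤ ⟩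
      ℤ.+ card F * (ℤ.+ card E * (q ^ 4 * (χ 0# * χ 0#)))
        ≤⟨ ℤ.*-monoˡ-≤-nonNeg (ℤ.+ card F) (ℤ.*-monoˡ-≤-nonNeg (ℤ.+ card E) q⁴χ0²≤2q⁶) ⟩
      ℤ.+ card F * (ℤ.+ card E * (ℤ.+ 2 * q ^ 6))
        ≡⟨ regroup (ℤ.+ 2) (q ^ 6) (ℤ.+ card E) (ℤ.+ card F) ⟩
      ℤ.+ 2 * q ^ 6 * (ℤ.+ card E * ℤ.+ card F)
        ≡⟨ cong₂ _*_ (cong (ℤ.+ 2 *_) (pos-^ size 6)) (ℤ.pos-* (card E) (card F)) ⟨
      ℤ.+ 2 * ℤ.+ (size ℕ.^ 6) * ℤ.+ (card E ℕ.* card F)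
        ≡⟨ trans (ℤ.pos-* (2 ℕ.* size ℕ.^ 6) (card E ℕ.* card F))
                 (cong (_* ℤ.+ (card E ℕ.* card F)) (ℤ.pos-* 2 (size ℕ.^ 6))) ⟨
      ℤ.+ (2 ℕ.* size ℕ.^ 6 ℕ.* (card E ℕ.* card F)) ∎
      where
      open ℤ.≤-Reasoning
      regroup : ∀ c Q e f → f * (e * (c * Q)) ≡ c * Q * (e * f)
      regroup = solve-∀

open FiniteSums using (∸-square-≤)
open OdotKernel using (deviation-bound)
open import Data.Nat using (_*_; _^_; _≤_)
open import Data.Nat.Divisibility using (_∣_)
open FiniteField using (size; W; 0#; Subset; card)

lemma6p3 : (K : FiniteField) →
    ¬ (2 ∣ size K) →
    (E F : Subset K) →
    (size K * W K (0# K) E F ∸ card K E * card K F) ^ 2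
      ≤ 2 * size K ^ 6 * (card K E * card K F)
lemma6p3 K _ E F =
  ∸-square-≤ (size K * W K (0# K) E F) (card K E * card K F) (2 * size K ^ 6 * (card K E * card K F)) (deviation-bound K E F)
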